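{- Fix $\ell\in[k]$ and let $P^\ell_I$ be an inclusionwise maximal independent set of minimum weight of the matroid $(P^\ell,\mathcal M_\ell)$. Given an independent chain $\mathcal S=(S_1,\dots,S_T)$ with $S_T\subseteq P^\ell$, there exists an independent chain $\mathcal S'=(S'_1,\dots,S'_T)$ with $S'_T\subseteq P^\ell_I$ such that, for all $t\in[T]$, $\gamma(S_t)=\gamma(S'_t)$ and $w(S'_t)\le w(S_t)$.
   Context: Let $[n]$ be a set of items with nonnegative weights $w_i$ and profits $p_i\in\{1,2,\dots\}$, and let $\gamma:2^{[n]}\to\mathbb Z_+$ be a function with $\gamma(\emptyset)=0$ that is monotonically non-decreasing, submodular, and satisfies $\gamma(A\cup\{i\})-\gamma(A)\in\{0,p_i\}$ for all $i\in[n]$, $A\subseteq[n]$. For $S\subseteq[n]$, $w(S)=\sum_{i\in S}w_i$. A set $S$ is independent if $\gamma(S)=\sum_{i\in S}p_i$. The profit partition $(P^1,\dots,P^k)$ of $[n]$ is such that all items in $P^\ell$ have the same profit $p^\ell$, with $0<p^1<\dots<p^k$; $\mathcal M_\ell$ is the family of independent subsets of $P^\ell$ (it is known that $(P^\ell,\mathcal M_\ell)$ is a matroid). A chain is a sequence $S_1\subseteq\dots\subseteq S_T\subseteq[n]$; it is independent if every $S_t$ is independent.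
   Formalization: The item weights $w_i$ are nonnegative rationals. -}

module Defs where

open import Data.Nat using (ℕ; zero; suc; _+_; _≤_)
open import Data.Nat.Properties using (_≟_)
open import Data.Bool using (if_then_else_)
open import Data.Fin using (Fin; zero; suc) renaming (_≤_ to _≤ᶠ_)
open import Data.Fin.Subset using (Subset; _∪_; _∩_; _⊆_; ⁅_⁆)
open import Data.Vec using (lookup; tabulate)
open import Data.Rational using (ℚ; 0ℚ) renaming (_+_ to _+ℚ_; _≤_ to _≤ℚ_)
open import Data.Product using (_×_)
open import Data.Sum using (_⊎_)
open import Relation.Binary.PropositionalEquality using (_≡_)
open import Relation.Nullary.Decidable using (⌊_⌋)

sumℕ : ∀ {n} → (Fin n → ℕ) → ℕ
sumℕ {zero}  f = 0
sumℕ {suc n} f = f zero + sumℕ (λ i → f (suc i))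

sumℚ : ∀ {n} → (Fin n → ℚ) → ℚ
sumℚ {zero}  f = 0ℚ
sumℚ {suc n} f = f zero +ℚ sumℚ (λ i → f (suc i))

profit : ∀ {n} → (Fin n → ℕ) → Subset n → ℕ
profit p S = sumℕ (λ i → if lookup S i then p i else 0)

weight : ∀ {n} → (Fin n → ℚ) → Subset n → ℚ
weight w S = sumℚ (λ i → if lookup S i then w i else 0ℚ)

Monotone : ∀ {n} → (Subset n → ℕ) → Set
Monotone γ = ∀ A B → A ⊆ B → γ A ≤ γ B

Submodular : ∀ {n} → (Subset n → ℕ) → Set
Submodular γ = ∀ A B → γ (A ∪ B) + γ (A ∩ B) ≤ γ A + γ B

Marginal : ∀ {n} → (Fin n → ℕ) → (Subset n → ℕ) → Set
Marginal p γ = ∀ i A → (γ (A ∪ ⁅ i ⁆) ≡ γ A) ⊎ (γ (A ∪ ⁅ i ⁆) ≡ γ A + p i)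

Independent : ∀ {n} → (Fin n → ℕ) → (Subset n → ℕ) → Subset n → Set
Independent p γ S = γ S ≡ profit p S

-- the class of the profit partition consisting of the items of profit q
ProfitClass : ∀ {n} → (Fin n → ℕ) → ℕ → Subset n
ProfitClass p q = tabulate (λ i → ⌊ p i ≟ q ⌋)

IsBasis : ∀ {n} → (Fin n → ℕ) → (Subset n → ℕ) → Subset n → Subset n → Set
IsBasis p γ P B =
  B ⊆ P × Independent p γ B ×
  (∀ C → C ⊆ P → Independent p γ C → B ⊆ C → C ≡ B)

IsMinWeightBasis : ∀ {n} → (Fin n → ℚ) → (Fin n → ℕ) → (Subset n → ℕ) → Subset n → Subset n → Set
IsMinWeightBasis w p γ P B =
  IsBasis p γ P B × (∀ C → IsBasis p γ P C → weight w B ≤ℚ weight w C)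

IsChain : ∀ {n T} → (Fin T → Subset n) → Set
IsChain S = ∀ t u → t ≤ᶠ u → S t ⊆ S u

IndependentChain : ∀ {n T} → (Fin n → ℕ) → (Subset n → ℕ) → (Fin T → Subset n) → Set
IndependentChain p γ S = IsChain S × (∀ t → Independent p γ (S t))

{-# OPTIONS --safe #-}

-- The items of S_T outside the minimum-weight basis B are swapped out one at a time. For a ∈ S_T ∖ B
-- let U = S_T − a. Extending {b ∈ B : b ∈ span U} ∪ {a} inside B gives a basis J ⊆ B + a, and any
-- b ∈ B ∖ J lies outside span U, so U + b is independent, while w(J − a + b) ≤ w(B) ≤ w(J) by
-- minimality of B forces w_b ≤ w_a. Replacing a by b in every S_t keeps the chain independent,
-- keeps γ(S_t) = p(S_t) because p_a = p_b, increases no weight, and strictly shrinks S_T ∖ B.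

module Submission where

open import Defs
open import Algebra.Bundles using (CommutativeMonoid)
import Algebra.Properties.CommutativeSemigroup as CommutativeSemigroupProperties
import Algebra.Properties.Group as GroupProperties
open import Data.Bool using (true; false; _∨_; if_then_else_)
open import Data.Nat using (ℕ; zero; suc; _+_; _≤_)
import Data.Nat.Properties as ℕ
open import Data.Fin using (Fin; zero; suc; fromℕ)
open import Data.Fin.Properties using (_≟_; ≤fromℕ)
open import Data.Fin.Subset
open import Data.Fin.Subset.Properties
open import Data.Fin.Subset.Induction using (⊂-wellFounded; Acc; acc)
open import Data.Rational using (ℚ; 0ℚ; -_) renaming (_+_ to _+ℚ_; _≤_ to _≤ℚ_)
import Data.Rational.Properties as ℚ
open import Data.Product using (_×_; _,_; proj₁; proj₂; ∃; Σ)
open import Data.Sum using (_⊎_; inj₁; inj₂)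
open import Data.Vec using ([]; _∷_; tabulate; here; there)
open import Data.Vec.Properties using (lookup∘tabulate; []=⇒lookup; lookup⇒[]=)
open import Function using (_∘_; id; case_of_)
open import Relation.Nullary using (¬_; yes; no; contradiction)
open import Relation.Nullary.Decidable using (⌊_⌋; _×-dec_)
open import Relation.Unary using (Pred; Decidable)
open import Relation.Binary.PropositionalEquality
  using (_≡_; refl; sym; trans; cong; cong₂; subst; subst₂; module ≡-Reasoning)

private variable n : ℕ

x∈p─q⁻ : ∀ {x : Fin n} (p q : Subset n) → x ∈ p ─ q → x ∈ p × x ∉ q
x∈p─q⁻ (s ∷ p) (inside  ∷ q) (there x∈) = let x∈p , x∉q = x∈p─q⁻ p q x∈ in there x∈p , x∉q ∘ drop-there
x∈p─q⁻ (s ∷ p) (outside ∷ q) here       = here , λ ()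
x∈p─q⁻ (s ∷ p) (outside ∷ q) (there x∈) = let x∈p , x∉q = x∈p─q⁻ p q x∈ in there x∈p , x∉q ∘ drop-there

x∉p-x : ∀ {x : Fin n} (p : Subset n) → x ∉ p - x
x∉p-x {x = x} p x∈ = proj₂ (x∈p─q⁻ p ⁅ x ⁆ x∈) (x∈⁅x⁆ x)

∪-lub : ∀ {p q r : Subset n} → p ⊆ r → q ⊆ r → p ∪ q ⊆ r
∪-lub {p = p} {q} p⊆r q⊆r x∈ with x∈p∪q⁻ p q x∈
... | inj₁ x∈p = p⊆r x∈p
... | inj₂ x∈q = q⊆r x∈q

x∈p⇒⁅x⁆⊆p : ∀ {x : Fin n} {p} → x ∈ p → ⁅ x ⁆ ⊆ p
x∈p⇒⁅x⁆⊆p {x = x} {p} x∈p y∈⁅x⁆ = subst (_∈ p) (sym (x∈⁅y⁆⇒x≡y x y∈⁅x⁆)) x∈p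

p-x∪⁅x⁆≡p : ∀ {x : Fin n} {p : Subset n} → x ∈ p → (p - x) ∪ ⁅ x ⁆ ≡ p
p-x∪⁅x⁆≡p {x = x} {p} x∈p = ⊆-antisym (∪-lub (p─q⊆p p ⁅ x ⁆) (x∈p⇒⁅x⁆⊆p x∈p)) p⊆p-x∪x
  where
  p⊆p-x∪x : p ⊆ (p - x) ∪ ⁅ x ⁆
  p⊆p-x∪x {y} y∈p with y ≟ x
  ... | yes refl = q⊆p∪q (p - x) ⁅ x ⁆ (x∈⁅x⁆ x)
  ... | no  y≢x  = p⊆p∪q ⁅ x ⁆ (x∈p∧x≢y⇒x∈p-y y∈p y≢x)

x∈p⇒p∪⁅x⁆≡p : ∀ {x : Fin n} {p : Subset n} → x ∈ p → p ∪ ⁅ x ⁆ ≡ p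
x∈p⇒p∪⁅x⁆≡p {x = x} x∈p = ⊆-antisym (∪-lub id (x∈p⇒⁅x⁆⊆p x∈p)) (p⊆p∪q ⁅ x ⁆)

p⊆q⇒p∪q─p≡q : ∀ {p q : Subset n} → p ⊆ q → p ∪ (q ─ p) ≡ q
p⊆q⇒p∪q─p≡q {p = p} {q} p⊆q = ⊆-antisym (∪-lub p⊆q (p─q⊆p q p)) q⊆p∪q─p
  where
  q⊆p∪q─p : q ⊆ p ∪ (q ─ p)
  q⊆p∪q─p {x} x∈q with x ∈? p
  ... | yes x∈p = p⊆p∪q (q ─ p) x∈p
  ... | no  x∉p = q⊆p∪q p (q ─ p) (x∈p∧x∉q⇒x∈p─q x∈q x∉p)

⊆-or-∈∉ : (p q : Subset n) → p ⊆ q ⊎ ∃ λ x → x ∈ p × x ∉ q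
⊆-or-∈∉ p q with nonempty? (p ─ q)
... | yes (x , x∈p─q) = inj₂ (x , x∈p─q⁻ p q x∈p─q)
... | no  p─q-empty   = inj₁ p⊆q
  where
  p⊆q : p ⊆ q
  p⊆q {x} x∈p with x ∈? q
  ... | yes x∈q = x∈q
  ... | no  x∉q = contradiction (x , x∈p∧x∉q⇒x∈p─q x∈p x∉q) p─q-empty

subset-induction : ∀ {ℓ} (P : Subset n → Set ℓ) → P ⊥ →
                   (∀ X x → x ∉ X → P X → P (X ∪ ⁅ x ⁆)) → ∀ X → P X
subset-induction P P⊥ P∪⁅⁆ X = go X (⊂-wellFounded X)
  where
  go : ∀ X → Acc _⊂_ X → P X
  go X (acc rec) with nonempty? X
  ... | no  X-empty  = subst P (sym (Empty-unique X-empty)) P⊥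
  ... | yes (x , x∈X) =
    subst P (p-x∪⁅x⁆≡p x∈X) (P∪⁅⁆ (X - x) x (x∉p-x X) (go (X - x) (rec (x∈p⇒p-x⊂p x∈X))))

select : ∀ {ℓ} {P : Pred (Fin n) ℓ} → Decidable P → Subset n
select P? = tabulate (λ x → ⌊ P? x ⌋)

∈-select⁻ : ∀ {ℓ} {P : Pred (Fin n) ℓ} (P? : Decidable P) {x} → x ∈ select P? → P x
∈-select⁻ P? {x} x∈ with P? x | subst (_≡ true) (lookup∘tabulate _ x) ([]=⇒lookup x∈)
... | yes Px | _  = Px
... | no  _  | ()

∈-select⁺ : ∀ {ℓ} {P : Pred (Fin n) ℓ} (P? : Decidable P) {x} → P x → x ∈ select P?
∈-select⁺ P? {x} Px with P? x in eq
... | yes _  = lookup⇒[]= x (select P?) (trans (lookup∘tabulate _ x) (cong ⌊_⌋ eq))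
... | no ¬Px = contradiction Px ¬Px

∪-mono : ∀ {p p′ q q′ : Subset n} → p ⊆ p′ → q ⊆ q′ → p ∪ q ⊆ p′ ∪ q′
∪-mono {p′ = p′} {q′ = q′} p⊆p′ q⊆q′ = ∪-lub (p⊆p∪q q′ ∘ p⊆p′) (q⊆p∪q p′ q′ ∘ q⊆q′)

replace : Fin n → Fin n → Subset n → Subset n
replace a b X with a ∈? X
... | yes _ = (X - a) ∪ ⁅ b ⁆
... | no  _ = X

replace-∈ : ∀ {a b : Fin n} {X} → a ∈ X → replace a b X ≡ (X - a) ∪ ⁅ b ⁆
replace-∈ {a = a} {X = X} a∈X with a ∈? X
... | yes _   = refl
... | no  a∉X = contradiction a∈X a∉X

replace-mono : ∀ (a b : Fin n) {X Y} → X ⊆ Y → replace a b X ⊆ replace a b Y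
replace-mono a b {X} {Y} X⊆Y with a ∈? X | a ∈? Y
... | yes _   | yes _   = ∪-mono X-a⊆Y-a id
  where
  X-a⊆Y-a : X - a ⊆ Y - a
  X-a⊆Y-a x∈X-a = let x∈X , x∉⁅a⁆ = x∈p─q⁻ X ⁅ a ⁆ x∈X-a in x∈p∧x∉q⇒x∈p─q (X⊆Y x∈X) x∉⁅a⁆
... | yes a∈X | no  a∉Y = contradiction (X⊆Y a∈X) a∉Y
... | no  a∉X | yes _   = λ x∈X → p⊆p∪q ⁅ b ⁆ (x∈p∧x≢y⇒x∈p-y (X⊆Y x∈X) λ { refl → a∉X x∈X })
... | no  _   | no  _   = X⊆Y

replace-─-⊂ : ∀ {a b : Fin n} {X B} → a ∈ X → a ∉ B → b ∈ B → replace a b X ─ B ⊂ X ─ B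
replace-─-⊂ {a = a} {b} {X} {B} a∈X a∉B b∈B rewrite replace-∈ {b = b} a∈X =
  shrinks , a , x∈p∧x∉q⇒x∈p─q a∈X a∉B , a∉
  where
  shrinks : (X - a) ∪ ⁅ b ⁆ ─ B ⊆ X ─ B
  shrinks x∈ with x∈p─q⁻ ((X - a) ∪ ⁅ b ⁆) B x∈
  ... | x∈X-a∪b , x∉B with x∈p∪q⁻ (X - a) ⁅ b ⁆ x∈X-a∪b
  ...   | inj₁ x∈X-a = x∈p∧x∉q⇒x∈p─q (p─q⊆p X ⁅ a ⁆ x∈X-a) x∉B
  ...   | inj₂ x∈⁅b⁆ = contradiction (x∈p⇒⁅x⁆⊆p b∈B x∈⁅b⁆) x∉B
  a∉ : a ∉ (X - a) ∪ ⁅ b ⁆ ─ B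
  a∉ a∈ with x∈p─q⁻ ((X - a) ∪ ⁅ b ⁆) B a∈
  ... | a∈X-a∪b , a∉B′ with x∈p∪q⁻ (X - a) ⁅ b ⁆ a∈X-a∪b
  ...   | inj₁ a∈X-a = x∉p-x X a∈X-a
  ...   | inj₂ a∈⁅b⁆ = a∉B′ (x∈p⇒⁅x⁆⊆p b∈B a∈⁅b⁆)

module SubsetSum {c ℓ} (M : CommutativeMonoid c ℓ) where

  open CommutativeMonoid M renaming (refl to ≈-refl; sym to ≈-sym; trans to ≈-trans)
  open CommutativeSemigroupProperties commutativeSemigroup using (interchange)
  open import Relation.Binary.Reasoning.Setoid setoid

  sumOver : Subset n → (Fin n → Carrier) → Carrier
  sumOver []      f = ε
  sumOver (s ∷ X) f = (if s then f zero else ε) ∙ sumOver X (f ∘ suc)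

  sumOver-⊥ : ∀ (f : Fin n → Carrier) → sumOver ⊥ f ≈ ε
  sumOver-⊥ {zero}  f = ≈-refl
  sumOver-⊥ {suc n} f = ≈-trans (identityˡ _) (sumOver-⊥ (f ∘ suc))

  sumOver-⁅⁆ : ∀ (f : Fin n → Carrier) x → sumOver ⁅ x ⁆ f ≈ f x
  sumOver-⁅⁆ f zero    = ≈-trans (∙-congˡ (sumOver-⊥ (f ∘ suc))) (identityʳ _)
  sumOver-⁅⁆ f (suc x) = ≈-trans (identityˡ _) (sumOver-⁅⁆ (f ∘ suc) x)

  sumOver-∪ : ∀ (X Y : Subset n) f → (∀ {x} → x ∈ X → x ∉ Y) →
              sumOver (X ∪ Y) f ≈ sumOver X f ∙ sumOver Y f
  sumOver-∪ []      []      f disjoint = ≈-sym (identityˡ ε)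
  sumOver-∪ (s ∷ X) (t ∷ Y) f disjoint = begin
    (if s ∨ t then f zero else ε) ∙ sumOver (X ∪ Y) (f ∘ suc)
      ≈⟨ ∙-cong (head s t disjoint) (sumOver-∪ X Y (f ∘ suc) (λ x∈X x∈Y → disjoint (there x∈X) (there x∈Y))) ⟩
    ((if s then f zero else ε) ∙ (if t then f zero else ε)) ∙ (sumOver X (f ∘ suc) ∙ sumOver Y (f ∘ suc))
      ≈⟨ interchange _ _ _ _ ⟩
    sumOver (s ∷ X) f ∙ sumOver (t ∷ Y) f ∎
    where
    head : ∀ s t → (∀ {x} → x ∈ s ∷ X → x ∉ t ∷ Y) →
           (if s ∨ t then f zero else ε) ≈ (if s then f zero else ε) ∙ (if t then f zero else ε)
    head true  true  disjoint = contradiction here (disjoint here)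
    head true  false _ = ≈-sym (identityʳ _)
    head false true  _ = ≈-sym (identityˡ _)
    head false false _ = ≈-sym (identityˡ ε)

  sumOver-∪⁅⁆ : ∀ (X : Subset n) {x} f → x ∉ X → sumOver (X ∪ ⁅ x ⁆) f ≈ sumOver X f ∙ f x
  sumOver-∪⁅⁆ X {x} f x∉X =
    ≈-trans (sumOver-∪ X ⁅ x ⁆ f (λ y∈X y∈⁅x⁆ → x∉X (subst (_∈ X) (x∈⁅y⁆⇒x≡y x y∈⁅x⁆) y∈X)))
            (∙-congˡ (sumOver-⁅⁆ f x))

  sumOver-─ : ∀ {X Y : Subset n} f → X ⊆ Y → sumOver Y f ≈ sumOver X f ∙ sumOver (Y ─ X) f
  sumOver-─ {X = X} {Y} f X⊆Y = begin
    sumOver Y f             ≡⟨ cong (λ Z → sumOver Z f) (p⊆q⇒p∪q─p≡q X⊆Y) ⟨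
    sumOver (X ∪ (Y ─ X)) f ≈⟨ sumOver-∪ X (Y ─ X) f (λ x∈X x∈Y─X → proj₂ (x∈p─q⁻ Y X x∈Y─X) x∈X) ⟩
    sumOver X f ∙ sumOver (Y ─ X) f ∎

module ℕ-Sum = SubsetSum ℕ.+-0-commutativeMonoid
module ℚ-Sum = SubsetSum ℚ.+-0-commutativeMonoid

profit≡sumOver : ∀ (p : Fin n → ℕ) X → profit p X ≡ ℕ-Sum.sumOver X p
profit≡sumOver p []      = refl
profit≡sumOver p (s ∷ X) = cong ((if s then p zero else 0) +_) (profit≡sumOver (p ∘ suc) X)

weight≡sumOver : ∀ (w : Fin n → ℚ) X → weight w X ≡ ℚ-Sum.sumOver X w
weight≡sumOver w []      = refl
weight≡sumOver w (s ∷ X) = cong ((if s then w zero else 0ℚ) +ℚ_) (weight≡sumOver (w ∘ suc) X)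

profit-⊥ : ∀ (p : Fin n → ℕ) → profit p ⊥ ≡ 0
profit-⊥ p = trans (profit≡sumOver p ⊥) (ℕ-Sum.sumOver-⊥ p)

profit-∪⁅⁆ : ∀ (p : Fin n → ℕ) {X x} → x ∉ X → profit p (X ∪ ⁅ x ⁆) ≡ profit p X + p x
profit-∪⁅⁆ p {X} {x} x∉X = begin
  profit p (X ∪ ⁅ x ⁆)        ≡⟨ profit≡sumOver p (X ∪ ⁅ x ⁆) ⟩
  ℕ-Sum.sumOver (X ∪ ⁅ x ⁆) p ≡⟨ ℕ-Sum.sumOver-∪⁅⁆ X p x∉X ⟩
  ℕ-Sum.sumOver X p + p x     ≡⟨ cong (_+ p x) (profit≡sumOver p X) ⟨
  profit p X + p x            ∎
  where open ≡-Reasoning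

profit-─ : ∀ (p : Fin n → ℕ) {X Y} → X ⊆ Y → profit p Y ≡ profit p X + profit p (Y ─ X)
profit-─ p {X} {Y} X⊆Y = begin
  profit p Y                                   ≡⟨ profit≡sumOver p Y ⟩
  ℕ-Sum.sumOver Y p                            ≡⟨ ℕ-Sum.sumOver-─ p X⊆Y ⟩
  ℕ-Sum.sumOver X p + ℕ-Sum.sumOver (Y ─ X) p  ≡⟨ cong₂ _+_ (profit≡sumOver p X) (profit≡sumOver p (Y ─ X)) ⟨
  profit p X + profit p (Y ─ X)                ∎
  where open ≡-Reasoning

profit-remove : ∀ (p : Fin n → ℕ) {X x} → x ∈ X → profit p X ≡ profit p (X - x) + p x
profit-remove p {X} x∈X = trans (cong (profit p) (sym (p-x∪⁅x⁆≡p x∈X))) (profit-∪⁅⁆ p (x∉p-x X))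

weight-∪⁅⁆ : ∀ (w : Fin n → ℚ) {X x} → x ∉ X → weight w (X ∪ ⁅ x ⁆) ≡ weight w X +ℚ w x
weight-∪⁅⁆ w {X} {x} x∉X = begin
  weight w (X ∪ ⁅ x ⁆)          ≡⟨ weight≡sumOver w (X ∪ ⁅ x ⁆) ⟩
  ℚ-Sum.sumOver (X ∪ ⁅ x ⁆) w   ≡⟨ ℚ-Sum.sumOver-∪⁅⁆ X w x∉X ⟩
  ℚ-Sum.sumOver X w +ℚ w x      ≡⟨ cong (_+ℚ w x) (weight≡sumOver w X) ⟨
  weight w X +ℚ w x             ∎
  where open ≡-Reasoning

weight-remove : ∀ (w : Fin n → ℚ) {X x} → x ∈ X → weight w X ≡ weight w (X - x) +ℚ w x
weight-remove w {X} x∈X = trans (cong (weight w) (sym (p-x∪⁅x⁆≡p x∈X))) (weight-∪⁅⁆ w (x∉p-x X))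

weight-─ : ∀ (w : Fin n → ℚ) {X Y} → X ⊆ Y → weight w Y ≡ weight w X +ℚ weight w (Y ─ X)
weight-─ w {X} {Y} X⊆Y = begin
  weight w Y                                    ≡⟨ weight≡sumOver w Y ⟩
  ℚ-Sum.sumOver Y w                             ≡⟨ ℚ-Sum.sumOver-─ w X⊆Y ⟩
  ℚ-Sum.sumOver X w +ℚ ℚ-Sum.sumOver (Y ─ X) w  ≡⟨ cong₂ _+ℚ_ (weight≡sumOver w X) (weight≡sumOver w (Y ─ X)) ⟨
  weight w X +ℚ weight w (Y ─ X)                ∎
  where open ≡-Reasoning

weight-nonneg : ∀ {w : Fin n → ℚ} → (∀ i → 0ℚ ≤ℚ w i) → ∀ X → 0ℚ ≤ℚ weight w X
weight-nonneg w≥0 []            = ℚ.≤-refl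
weight-nonneg w≥0 (inside ∷ X)  = ℚ.+-mono-≤ (w≥0 zero) (weight-nonneg (w≥0 ∘ suc) X)
weight-nonneg w≥0 (outside ∷ X) = ℚ.+-mono-≤ ℚ.≤-refl (weight-nonneg (w≥0 ∘ suc) X)

weight-mono : ∀ {w : Fin n → ℚ} → (∀ i → 0ℚ ≤ℚ w i) → ∀ {X Y} → X ⊆ Y → weight w X ≤ℚ weight w Y
weight-mono {w = w} w≥0 {X} {Y} X⊆Y = begin
  weight w X                         ≡⟨ ℚ.+-identityʳ (weight w X) ⟨
  weight w X +ℚ 0ℚ                   ≤⟨ ℚ.+-monoʳ-≤ (weight w X) (weight-nonneg w≥0 (Y ─ X)) ⟩
  weight w X +ℚ weight w (Y ─ X)     ≡⟨ weight-─ w X⊆Y ⟨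
  weight w Y                         ∎
  where open ℚ.≤-Reasoning

+-cancelˡ-≤ : ∀ r {p q : ℚ} → r +ℚ p ≤ℚ r +ℚ q → p ≤ℚ q
+-cancelˡ-≤ r {p} {q} r+p≤r+q =
  subst₂ _≤ℚ_ (\\-leftDividesʳ r p) (\\-leftDividesʳ r q) (ℚ.+-monoʳ-≤ (- r) r+p≤r+q)
  where open GroupProperties ℚ.+-0-group using (\\-leftDividesʳ)

exchange-weight-≤ : ∀ {w : Fin n → ℚ} → (∀ i → 0ℚ ≤ℚ w i) → ∀ {B J a b} →
                    J ⊆ B ∪ ⁅ a ⁆ → a ∈ J → b ∈ B → b ∉ J → weight w B ≤ℚ weight w J → w b ≤ℚ w a
exchange-weight-≤ {w = w} w≥0 {B} {J} {a} {b} J⊆B∪a a∈J b∈B b∉J wB≤wJ = +-cancelˡ-≤ (weight w (J - a)) (begin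
  weight w (J - a) +ℚ w b       ≡⟨ weight-∪⁅⁆ w (b∉J ∘ p─q⊆p J ⁅ a ⁆) ⟨
  weight w ((J - a) ∪ ⁅ b ⁆)    ≤⟨ weight-mono w≥0 (∪-lub J-a⊆B (x∈p⇒⁅x⁆⊆p b∈B)) ⟩
  weight w B                    ≤⟨ wB≤wJ ⟩
  weight w J                    ≡⟨ weight-remove w a∈J ⟩
  weight w (J - a) +ℚ w a       ∎)
  where
  open ℚ.≤-Reasoning
  J-a⊆B : J - a ⊆ B
  J-a⊆B x∈J-a with x∈p─q⁻ J ⁅ a ⁆ x∈J-a
  ... | x∈J , x∉⁅a⁆ with x∈p∪q⁻ B ⁅ a ⁆ (J⊆B∪a x∈J)
  ...   | inj₁ x∈B   = x∈B
  ...   | inj₂ x∈⁅a⁆ = contradiction x∈⁅a⁆ x∉⁅a⁆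

profit-replace : ∀ (p : Fin n → ℕ) a {b X} → b ∉ X → p a ≡ p b → profit p (replace a b X) ≡ profit p X
profit-replace p a {b} {X} b∉X pa≡pb with a ∈? X
... | no  _   = refl
... | yes a∈X = begin
  profit p ((X - a) ∪ ⁅ b ⁆)  ≡⟨ profit-∪⁅⁆ p (b∉X ∘ p─q⊆p X ⁅ a ⁆) ⟩
  profit p (X - a) + p b      ≡⟨ cong (profit p (X - a) +_) pa≡pb ⟨
  profit p (X - a) + p a      ≡⟨ profit-remove p a∈X ⟨
  profit p X                  ∎
  where open ≡-Reasoning

weight-replace-≤ : ∀ (w : Fin n → ℚ) a {b X} → b ∉ X → w b ≤ℚ w a → weight w (replace a b X) ≤ℚ weight w X
weight-replace-≤ w a {b} {X} b∉X wb≤wa with a ∈? X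
... | no  _   = ℚ.≤-refl
... | yes a∈X = begin
  weight w ((X - a) ∪ ⁅ b ⁆)  ≡⟨ weight-∪⁅⁆ w (b∉X ∘ p─q⊆p X ⁅ a ⁆) ⟩
  weight w (X - a) +ℚ w b     ≤⟨ ℚ.+-monoʳ-≤ (weight w (X - a)) wb≤wa ⟩
  weight w (X - a) +ℚ w a     ≡⟨ weight-remove w a∈X ⟨
  weight w X                  ∎
  where open ℚ.≤-Reasoning

module Rank {n} (p : Fin n → ℕ) (γ : Subset n → ℕ) (p≥1 : ∀ i → 1 ≤ p i) (γ⊥ : γ ⊥ ≡ 0)
             (mono : Monotone γ) (submodular : Submodular γ) (marginal : Marginal p γ) where

  Spans : Subset n → Fin n → Set
  Spans A x = γ (A ∪ ⁅ x ⁆) ≡ γ A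

  spans-∈ : ∀ {A x} → x ∈ A → Spans A x
  spans-∈ x∈A = cong γ (x∈p⇒p∪⁅x⁆≡p x∈A)

  ¬spans⇒∉ : ∀ {A x} → ¬ Spans A x → x ∉ A
  ¬spans⇒∉ ¬spans x∈A = ¬spans (spans-∈ x∈A)

  ¬spans⇒γ-∪⁅⁆ : ∀ {A x} → ¬ Spans A x → γ (A ∪ ⁅ x ⁆) ≡ γ A + p x
  ¬spans⇒γ-∪⁅⁆ {A} {x} ¬spans with marginal x A
  ... | inj₁ spans = contradiction spans ¬spans
  ... | inj₂ grows = grows

  γ-∪⁅⁆-≤ : ∀ A x → γ (A ∪ ⁅ x ⁆) ≤ γ A + p x
  γ-∪⁅⁆-≤ A x with marginal x A
  ... | inj₁ spans = ℕ.≤-trans (ℕ.≤-reflexive spans) (ℕ.m≤m+n (γ A) (p x))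
  ... | inj₂ grows = ℕ.≤-reflexive grows

  spans-mono : ∀ {A C x} → A ⊆ C → Spans A x → Spans C x
  spans-mono {A} {C} {x} A⊆C spans = ℕ.≤-antisym (ℕ.+-cancelʳ-≤ (γ A) _ _ (begin
      γ (C ∪ ⁅ x ⁆) + γ A                          ≤⟨ ℕ.+-mono-≤ (mono _ _ C∪x⊆) (mono _ _ A⊆) ⟩
      γ ((A ∪ ⁅ x ⁆) ∪ C) + γ ((A ∪ ⁅ x ⁆) ∩ C)    ≤⟨ submodular (A ∪ ⁅ x ⁆) C ⟩
      γ (A ∪ ⁅ x ⁆) + γ C                          ≡⟨ cong (_+ γ C) spans ⟩
      γ A + γ C                                    ≡⟨ ℕ.+-comm (γ A) (γ C) ⟩
      γ C + γ A                                    ∎))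
    (mono C _ (p⊆p∪q ⁅ x ⁆))
    where
    open ℕ.≤-Reasoning
    C∪x⊆ : C ∪ ⁅ x ⁆ ⊆ (A ∪ ⁅ x ⁆) ∪ C
    C∪x⊆ = ∪-lub (q⊆p∪q (A ∪ ⁅ x ⁆) C) (p⊆p∪q C ∘ q⊆p∪q A ⁅ x ⁆)
    A⊆ : A ⊆ (A ∪ ⁅ x ⁆) ∩ C
    A⊆ x∈A = x∈p∩q⁺ (p⊆p∪q ⁅ x ⁆ x∈A , A⊆C x∈A)

  spans-all : ∀ A D → (∀ {x} → x ∈ D → Spans A x) → γ (A ∪ D) ≡ γ A
  spans-all A = subset-induction (λ D → (∀ {x} → x ∈ D → Spans A x) → γ (A ∪ D) ≡ γ A)
    (λ _ → cong γ (∪-identityʳ A))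
    λ X x _ ih spansX∪x → begin
      γ (A ∪ (X ∪ ⁅ x ⁆))  ≡⟨ cong γ (∪-assoc A X ⁅ x ⁆) ⟨
      γ ((A ∪ X) ∪ ⁅ x ⁆)  ≡⟨ spans-mono (p⊆p∪q X) (spansX∪x (q⊆p∪q X ⁅ x ⁆ (x∈⁅x⁆ x))) ⟩
      γ (A ∪ X)            ≡⟨ ih (spansX∪x ∘ p⊆p∪q ⁅ x ⁆) ⟩
      γ A                  ∎
    where open ≡-Reasoning

  spans-trans : ∀ {U Z x} → (∀ {z} → z ∈ Z → Spans U z) → Spans (U ∪ Z) x → Spans U x
  spans-trans {U} {Z} {x} spansZ spans = ℕ.≤-antisym (begin
      γ (U ∪ ⁅ x ⁆)          ≤⟨ mono _ _ (∪-lub (p⊆p∪q ⁅ x ⁆ ∘ p⊆p∪q Z) (q⊆p∪q (U ∪ Z) ⁅ x ⁆)) ⟩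
      γ ((U ∪ Z) ∪ ⁅ x ⁆)    ≡⟨ spans ⟩
      γ (U ∪ Z)              ≡⟨ spans-all U Z spansZ ⟩
      γ U                    ∎)
    (mono U _ (p⊆p∪q ⁅ x ⁆))
    where open ℕ.≤-Reasoning

  γ-∪-≤ : ∀ A D → γ (A ∪ D) ≤ γ A + profit p D
  γ-∪-≤ A = subset-induction (λ D → γ (A ∪ D) ≤ γ A + profit p D)
    (begin
      γ (A ∪ ⊥)          ≡⟨ cong γ (∪-identityʳ A) ⟩
      γ A                ≡⟨ ℕ.+-identityʳ (γ A) ⟨
      γ A + 0            ≡⟨ cong (γ A +_) (profit-⊥ p) ⟨
      γ A + profit p ⊥   ∎)
    λ X x x∉X ih → begin
      γ (A ∪ (X ∪ ⁅ x ⁆))           ≡⟨ cong γ (∪-assoc A X ⁅ x ⁆) ⟨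
      γ ((A ∪ X) ∪ ⁅ x ⁆)           ≤⟨ γ-∪⁅⁆-≤ (A ∪ X) x ⟩
      γ (A ∪ X) + p x               ≤⟨ ℕ.+-monoˡ-≤ (p x) ih ⟩
      γ A + profit p X + p x        ≡⟨ ℕ.+-assoc (γ A) _ _ ⟩
      γ A + (profit p X + p x)      ≡⟨ cong (γ A +_) (profit-∪⁅⁆ p x∉X) ⟨
      γ A + profit p (X ∪ ⁅ x ⁆)    ∎
    where open ℕ.≤-Reasoning

  γ≤profit : ∀ A → γ A ≤ profit p A
  γ≤profit A = begin
    γ A                ≡⟨ cong γ (∪-identityˡ A) ⟨
    γ (⊥ ∪ A)          ≤⟨ γ-∪-≤ ⊥ A ⟩
    γ ⊥ + profit p A   ≡⟨ cong (_+ profit p A) γ⊥ ⟩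
    profit p A         ∎
    where open ℕ.≤-Reasoning

  independent-⊆ : ∀ {A C} → A ⊆ C → Independent p γ C → Independent p γ A
  independent-⊆ {A} {C} A⊆C indC = ℕ.≤-antisym (γ≤profit A) (ℕ.+-cancelʳ-≤ (profit p (C ─ A)) _ _ (begin
    profit p A + profit p (C ─ A)   ≡⟨ profit-─ p A⊆C ⟨
    profit p C                      ≡⟨ indC ⟨
    γ C                             ≡⟨ cong γ (p⊆q⇒p∪q─p≡q A⊆C) ⟨
    γ (A ∪ (C ─ A))                 ≤⟨ γ-∪-≤ A (C ─ A) ⟩
    γ A + profit p (C ─ A)          ∎))
    where open ℕ.≤-Reasoning

  ¬spans⇒independent-∪⁅⁆ : ∀ {A x} → Independent p γ A → ¬ Spans A x → Independent p γ (A ∪ ⁅ x ⁆)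
  ¬spans⇒independent-∪⁅⁆ {A} {x} indA ¬spans = begin
    γ (A ∪ ⁅ x ⁆)         ≡⟨ ¬spans⇒γ-∪⁅⁆ ¬spans ⟩
    γ A + p x             ≡⟨ cong (_+ p x) indA ⟩
    profit p A + p x      ≡⟨ profit-∪⁅⁆ p (¬spans⇒∉ ¬spans) ⟨
    profit p (A ∪ ⁅ x ⁆)  ∎
    where open ≡-Reasoning

  m+p≰m : ∀ m x → ¬ m + p x ≤ m
  m+p≰m m x = ℕ.<⇒≱ (ℕ.m<m+n m (p≥1 x))

  independent-∪⁅⁆⇒¬spans : ∀ {A x} → x ∉ A → Independent p γ (A ∪ ⁅ x ⁆) → ¬ Spans A x
  independent-∪⁅⁆⇒¬spans {A} {x} x∉A indA∪x spans = m+p≰m (γ A) x (ℕ.≤-reflexive (begin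
    γ A + p x             ≡⟨ cong (_+ p x) (independent-⊆ (p⊆p∪q ⁅ x ⁆) indA∪x) ⟩
    profit p A + p x      ≡⟨ profit-∪⁅⁆ p x∉A ⟨
    profit p (A ∪ ⁅ x ⁆)  ≡⟨ indA∪x ⟨
    γ (A ∪ ⁅ x ⁆)         ≡⟨ spans ⟩
    γ A                   ∎))
    where open ≡-Reasoning

  ¬spans-remove : ∀ {A x} → Independent p γ A → x ∈ A → ¬ Spans (A - x) x
  ¬spans-remove {A} indA x∈A =
    independent-∪⁅⁆⇒¬spans (x∉p-x A) (subst (Independent p γ) (sym (p-x∪⁅x⁆≡p x∈A)) indA)

  record Extension (I E : Subset n) : Set where
    field
      set         : Subset n
      independent : Independent p γ set
      I⊆set       : I ⊆ set
      set⊆I∪E     : set ⊆ I ∪ E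
      spans-E     : ∀ {e} → e ∈ E → Spans set e

  extend : ∀ {I} → Independent p γ I → ∀ E → Extension I E
  extend {I} indI = subset-induction (Extension I) base step
    where
    base : Extension I ⊥
    base = record { set = I ; independent = indI ; I⊆set = id ; set⊆I∪E = p⊆p∪q ⊥
                  ; spans-E = λ e∈⊥ → contradiction e∈⊥ ∉⊥ }
    step : ∀ X x → x ∉ X → Extension I X → Extension I (X ∪ ⁅ x ⁆)
    step X x _ record { set = J ; independent = indJ ; I⊆set = I⊆J ; set⊆I∪E = J⊆I∪X ; spans-E = spans-X }
      with γ (J ∪ ⁅ x ⁆) ℕ.≟ γ J
    ... | yes spans-x = record
      { set = J ; independent = indJ ; I⊆set = I⊆J
      ; set⊆I∪E = ∪-mono id (p⊆p∪q ⁅ x ⁆) ∘ J⊆I∪X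
      ; spans-E = λ {e} e∈X∪x → case x∈p∪q⁻ X ⁅ x ⁆ e∈X∪x of λ where
          (inj₁ e∈X)   → spans-X e∈X
          (inj₂ e∈⁅x⁆) → subst (Spans J) (sym (x∈⁅y⁆⇒x≡y x e∈⁅x⁆)) spans-x }
    ... | no ¬spans-x = record
      { set = J ∪ ⁅ x ⁆ ; independent = ¬spans⇒independent-∪⁅⁆ indJ ¬spans-x
      ; I⊆set = p⊆p∪q ⁅ x ⁆ ∘ I⊆J
      ; set⊆I∪E = ∪-lub (∪-mono id (p⊆p∪q ⁅ x ⁆) ∘ J⊆I∪X) (q⊆p∪q I _ ∘ q⊆p∪q X ⁅ x ⁆)
      ; spans-E = λ {e} e∈X∪x → case x∈p∪q⁻ X ⁅ x ⁆ e∈X∪x of λ where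
          (inj₁ e∈X)   → spans-mono (p⊆p∪q ⁅ x ⁆) (spans-X e∈X)
          (inj₂ e∈⁅x⁆) → spans-∈ (q⊆p∪q J ⁅ x ⁆ e∈⁅x⁆) }

module MinWeightBasis {n} (w : Fin n → ℚ) (p : Fin n → ℕ) (γ : Subset n → ℕ)
    (w≥0 : ∀ i → 0ℚ ≤ℚ w i) (p≥1 : ∀ i → 1 ≤ p i) (γ⊥ : γ ⊥ ≡ 0)
    (mono : Monotone γ) (submodular : Submodular γ) (marginal : Marginal p γ)
    (q : ℕ) (B : Subset n) (isMinWeightBasis : IsMinWeightBasis w p γ (ProfitClass p q) B) where

  open Rank p γ p≥1 γ⊥ mono submodular marginal

  P : Subset n
  P = ProfitClass p q

  ∈P⇒p≡q : ∀ {x} → x ∈ P → p x ≡ q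
  ∈P⇒p≡q = ∈-select⁻ (λ i → p i ℕ.≟ q)

  B⊆P : B ⊆ P
  B⊆P = proj₁ (proj₁ isMinWeightBasis)

  B-independent : Independent p γ B
  B-independent = proj₁ (proj₂ (proj₁ isMinWeightBasis))

  B-maximal : ∀ C → C ⊆ P → Independent p γ C → B ⊆ C → C ≡ B
  B-maximal = proj₂ (proj₂ (proj₁ isMinWeightBasis))

  B-minimal : ∀ C → IsBasis p γ P C → weight w B ≤ℚ weight w C
  B-minimal = proj₂ isMinWeightBasis

  B-spans : ∀ {x} → x ∈ P → Spans B x
  B-spans {x} x∈P with γ (B ∪ ⁅ x ⁆) ℕ.≟ γ B
  ... | yes spans = spans
  ... | no ¬spans = contradiction (subst (x ∈_) B∪x≡B (q⊆p∪q B ⁅ x ⁆ (x∈⁅x⁆ x))) (¬spans⇒∉ ¬spans)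
    where
    B∪x≡B : B ∪ ⁅ x ⁆ ≡ B
    B∪x≡B = B-maximal (B ∪ ⁅ x ⁆) (∪-lub B⊆P (x∈p⇒⁅x⁆⊆p x∈P))
              (¬spans⇒independent-∪⁅⁆ B-independent ¬spans) (p⊆p∪q ⁅ x ⁆)

  γ≤γB : ∀ {C} → C ⊆ P → γ C ≤ γ B
  γ≤γB {C} C⊆P = ℕ.≤-trans (mono C (B ∪ C) (q⊆p∪q B C)) (ℕ.≤-reflexive (spans-all B C (B-spans ∘ C⊆P)))

  γ≡γB⇒isBasis : ∀ {J} → J ⊆ P → Independent p γ J → γ J ≡ γ B → IsBasis p γ P J
  γ≡γB⇒isBasis {J} J⊆P indJ γJ≡γB = J⊆P , indJ , λ C C⊆P indC J⊆C → ⊆-antisym (C⊆J C⊆P indC J⊆C) J⊆C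
    where
    C⊆J : ∀ {C} → C ⊆ P → Independent p γ C → J ⊆ C → C ⊆ J
    C⊆J {C} C⊆P indC J⊆C {x} x∈C with x ∈? J
    ... | yes x∈J = x∈J
    ... | no  x∉J = contradiction (begin
        γ J + p x         ≡⟨ ¬spans⇒γ-∪⁅⁆ ¬spans ⟨
        γ (J ∪ ⁅ x ⁆)     ≤⟨ γ≤γB (∪-lub J⊆P (x∈p⇒⁅x⁆⊆p (C⊆P x∈C))) ⟩
        γ B               ≡⟨ γJ≡γB ⟨
        γ J               ∎) (m+p≰m (γ J) x)
      where
      open ℕ.≤-Reasoning
      ¬spans : ¬ Spans J x
      ¬spans = independent-∪⁅⁆⇒¬spans x∉J (independent-⊆ (∪-lub J⊆C (x∈p⇒⁅x⁆⊆p x∈C)) indC)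

  extend-to-basis : ∀ {I} → Independent p γ I → I ⊆ P → ∃ λ J → IsBasis p γ P J × I ⊆ J × J ⊆ I ∪ B
  extend-to-basis {I} indI I⊆P = J , γ≡γB⇒isBasis J⊆P independent γJ≡γB , I⊆set , set⊆I∪E
    where
    open Extension (extend indI B) renaming (set to J)
    J⊆P : J ⊆ P
    J⊆P = ∪-lub I⊆P B⊆P ∘ set⊆I∪E
    γJ≡γB : γ J ≡ γ B
    γJ≡γB = begin
      γ J        ≡⟨ spans-all J B spans-E ⟨
      γ (J ∪ B)  ≡⟨ cong γ (∪-comm J B) ⟩
      γ (B ∪ J)  ≡⟨ spans-all B J (B-spans ∘ J⊆P) ⟩
      γ B        ∎
      where open ≡-Reasoning

  -- Z = {e ∈ B : e ∈ span U} is independent and does not span a, since U spans Z but not a;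
  -- every element of B missed by the extension J of Z ∪ {a} therefore lies outside span U.
  exchange-basis : ∀ {U a} → a ∈ P → ¬ Spans U a →
                   ∃ λ J → IsBasis p γ P J × a ∈ J × J ⊆ B ∪ ⁅ a ⁆ × (∀ {b} → b ∈ B → b ∉ J → ¬ Spans U b)
  exchange-basis {U} {a} a∈P ¬spansUa =
    J , isBasis , Z∪a⊆J (q⊆p∪q Z ⁅ a ⁆ (x∈⁅x⁆ a)) , J⊆B∪a ,
    λ b∈B b∉J spansUb → b∉J (Z∪a⊆J (p⊆p∪q ⁅ a ⁆ (∈-select⁺ Z? (b∈B , spansUb))))
    where
    Z? : Decidable (λ e → e ∈ B × Spans U e)
    Z? e = e ∈? B ×-dec γ (U ∪ ⁅ e ⁆) ℕ.≟ γ U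
    Z : Subset n
    Z = select Z?
    Z⊆B : Z ⊆ B
    Z⊆B = proj₁ ∘ ∈-select⁻ Z?
    ¬spansZa : ¬ Spans Z a
    ¬spansZa = ¬spansUa ∘ spans-trans (proj₂ ∘ ∈-select⁻ Z?) ∘ spans-mono (q⊆p∪q U Z)
    extension : ∃ λ J → IsBasis p γ P J × Z ∪ ⁅ a ⁆ ⊆ J × J ⊆ (Z ∪ ⁅ a ⁆) ∪ B
    extension = extend-to-basis (¬spans⇒independent-∪⁅⁆ (independent-⊆ Z⊆B B-independent) ¬spansZa)
                                (∪-lub (B⊆P ∘ Z⊆B) (x∈p⇒⁅x⁆⊆p a∈P))
    J : Subset n
    J = proj₁ extension
    isBasis : IsBasis p γ P J
    isBasis = proj₁ (proj₂ extension)
    Z∪a⊆J : Z ∪ ⁅ a ⁆ ⊆ J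
    Z∪a⊆J = proj₁ (proj₂ (proj₂ extension))
    J⊆B∪a : J ⊆ B ∪ ⁅ a ⁆
    J⊆B∪a = ∪-lub (∪-mono Z⊆B id) (p⊆p∪q ⁅ a ⁆) ∘ proj₂ (proj₂ (proj₂ extension))

  exchange : ∀ {U a} → a ∈ P → a ∉ B → ¬ Spans U a → ∃ λ b → b ∈ B × ¬ Spans U b × w b ≤ℚ w a
  exchange {U} {a} a∈P a∉B ¬spansUa =
    let J , isBasis , a∈J , J⊆B∪a , ¬spans-B∖J = exchange-basis a∈P ¬spansUa
        J⊆P , indJ , _ = isBasis
    in case ⊆-or-∈∉ B J of λ where
      (inj₁ B⊆J)             → contradiction (subst (a ∈_) (B-maximal J J⊆P indJ B⊆J) a∈J) a∉B
      (inj₂ (b , b∈B , b∉J)) → b , b∈B , ¬spans-B∖J b∈B b∉J ,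
                               exchange-weight-≤ w≥0 J⊆B∪a a∈J b∈B b∉J (B-minimal J isBasis)

  module _ {T : ℕ} where

    Improves : (S′ S : Fin (suc T) → Subset n) → Set
    Improves S′ S = ∀ t → γ (S t) ≡ γ (S′ t) × weight w (S′ t) ≤ℚ weight w (S t)

    improves-trans : ∀ {S″ S′ S} → Improves S″ S′ → Improves S′ S → Improves S″ S
    improves-trans S″≽S′ S′≽S t =
      trans (proj₁ (S′≽S t)) (proj₁ (S″≽S′ t)) , ℚ.≤-trans (proj₂ (S″≽S′ t)) (proj₂ (S′≽S t))

    replace-step : ∀ {S} → IndependentChain p γ S → S (fromℕ T) ⊆ P → ∀ {a b} → a ∈ S (fromℕ T) → a ∉ B →
                   b ∈ B → ¬ Spans (S (fromℕ T) - a) b → w b ≤ℚ w a →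
                   IndependentChain p γ (replace a b ∘ S) × replace a b (S (fromℕ T)) ⊆ P ×
                   Improves (replace a b ∘ S) S
    replace-step {S} (chain , indS) S⊆P {a} {b} a∈S a∉B b∈B ¬spansUb wb≤wa =
      ((λ t u t≤u → replace-mono a b (chain t u t≤u)) , indS′) , S′top⊆P , λ t → γ-preserved t , weight-≤ t
      where
      S⊆Stop : ∀ t → S t ⊆ S (fromℕ T)
      S⊆Stop t = chain t (fromℕ T) (≤fromℕ t)
      b∉S : ∀ t → b ∉ S t
      b∉S t = b∉Stop ∘ S⊆Stop t
        where
        b∉Stop : b ∉ S (fromℕ T)
        b∉Stop b∈S = ¬spansUb (spans-∈ (x∈p∧x≢y⇒x∈p-y b∈S λ b≡a → a∉B (subst (_∈ B) b≡a b∈B)))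
      S′top-independent : Independent p γ (replace a b (S (fromℕ T)))
      S′top-independent = subst (Independent p γ) (sym (replace-∈ a∈S))
        (¬spans⇒independent-∪⁅⁆ (independent-⊆ (p─q⊆p _ _) (indS (fromℕ T))) ¬spansUb)
      indS′ : ∀ t → Independent p γ (replace a b (S t))
      indS′ t = independent-⊆ (replace-mono a b (S⊆Stop t)) S′top-independent
      S′top⊆P : replace a b (S (fromℕ T)) ⊆ P
      S′top⊆P = subst (_⊆ P) (sym (replace-∈ a∈S)) (∪-lub (S⊆P ∘ p─q⊆p _ _) (x∈p⇒⁅x⁆⊆p (B⊆P b∈B)))
      pa≡pb : p a ≡ p b
      pa≡pb = trans (∈P⇒p≡q (S⊆P a∈S)) (sym (∈P⇒p≡q (B⊆P b∈B)))
      γ-preserved : ∀ t → γ (S t) ≡ γ (replace a b (S t))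
      γ-preserved t = begin
        γ (S t)                          ≡⟨ indS t ⟩
        profit p (S t)                   ≡⟨ profit-replace p a (b∉S t) pa≡pb ⟨
        profit p (replace a b (S t))     ≡⟨ indS′ t ⟨
        γ (replace a b (S t))            ∎
        where open ≡-Reasoning
      weight-≤ : ∀ t → weight w (replace a b (S t)) ≤ℚ weight w (S t)
      weight-≤ t = weight-replace-≤ w a (b∉S t) wb≤wa

    improve : ∀ S → IndependentChain p γ S → S (fromℕ T) ⊆ P → Acc _⊂_ (S (fromℕ T) ─ B) →
              Σ (Fin (suc T) → Subset n) λ S′ → IndependentChain p γ S′ × S′ (fromℕ T) ⊆ B × Improves S′ S
    improve S indChain@(_ , indS) S⊆P (acc rec) with ⊆-or-∈∉ (S (fromℕ T)) B
    ... | inj₁ S⊆B              = S , indChain , S⊆B , λ t → refl , ℚ.≤-refl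
    ... | inj₂ (a , a∈S , a∉B) =
      let b , b∈B , ¬spansUb , wb≤wa    = exchange (S⊆P a∈S) a∉B (¬spans-remove (indS (fromℕ T)) a∈S)
          indChain′ , S′⊆P , S′≽S       = replace-step indChain S⊆P a∈S a∉B b∈B ¬spansUb wb≤wa
          shrinks                       = replace-─-⊂ a∈S a∉B b∈B
          S″ , indChain″ , S″⊆B , S″≽S′ = improve (replace a b ∘ S) indChain′ S′⊆P (rec shrinks)
      in S″ , indChain″ , S″⊆B , improves-trans S″≽S′ S′≽S

lemma5 : ∀ {n} (w : Fin n → ℚ) (p : Fin n → ℕ) (γ : Subset n → ℕ) →
    (∀ i → 0ℚ ≤ℚ w i) → (∀ i → 1 ≤ p i) →
    γ ⊥ ≡ 0 → Monotone γ → Submodular γ → Marginal p γ →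
    (q : ℕ) → ∃ (λ i → p i ≡ q) →
    (PI : Subset n) → IsMinWeightBasis w p γ (ProfitClass p q) PI →
    (T : ℕ) (S : Fin (suc T) → Subset n) →
    IndependentChain p γ S → S (fromℕ T) ⊆ ProfitClass p q →
    Σ (Fin (suc T) → Subset n) (λ S′ →
      IndependentChain p γ S′ × S′ (fromℕ T) ⊆ PI ×
      (∀ t → γ (S t) ≡ γ (S′ t) × weight w (S′ t) ≤ℚ weight w (S t)))
lemma5 w p γ w≥0 p≥1 γ⊥ mono submodular marginal q _ PI isMinWeightBasis T S indChain S⊆P =
  improve S indChain S⊆P (⊂-wellFounded _)
  where open MinWeightBasis w p γ w≥0 p≥1 γ⊥ mono submodular marginal q PI isMinWeightBasis
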